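{- Let $n\geq 1$, let $a=(0,a_2,\ldots,a_k)$ (with $k\geq 2$) be an $(n-1)$-admissible $k$-tuple such that $gap(a)<p_n-1$, and let $t$ be an $n$-totative number satisfying $a$ at level $n$. Then there exist an $(n-1)$-totative number $t'$ and $j\in\{0,1,\ldots,p_n-1\}$ such that $t=t'+\#(n-1)\,j$ and $t'$ satisfies $a$ at level $n-1$.
   Context: $p_i$ denotes the $i$th prime. The primorial is $\#(0)=1$ and $\#(m)=\prod_{i=1}^{m}p_i$ for $m\geq 1$. The $m$-primorial set is $\{2,\ldots,\#(m)+1\}$; an $m$-totative number is an element of it coprime to $\#(m)$. For a $k$-tuple $a=(a_1,\ldots,a_k)$ of natural numbers and an integer $t$, write $a[t]=(t+a_1,\ldots,t+a_k)$. An $m$-totative number $t$ satisfies $a$ at level $m$ if every entry of $a[t]$ is $m$-totative. The tuple $a$ is $m$-admissible if $a_1=0$, $a_{i-1}<a_i$ for $i=2,\ldots,k$, and for every $m'\geq m$ some $m'$-totative number satisfies $a$ at level $m'$. The gap of $a$ is $gap(a)=\max\{a_i-a_{i-1} : i=2,\ldots,k\}$. -}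

module Defs where

open import Data.Nat using (ℕ; zero; suc; _+_; _*_; _∸_; _≤_; _<_; _⊔_; _!)
open import Data.Nat.Primality using (prime?)
open import Data.Nat.Coprimality using (Coprime)
open import Data.Fin using (Fin; toℕ)
open import Data.Vec using (Vec; []; _∷_; lookup)
open import Data.Product using (Σ; _×_)
open import Relation.Binary.PropositionalEquality using (_≡_)
open import Relation.Nullary using (yes; no)

searchPrime : ℕ → ℕ → ℕ
searchPrime zero k = k
searchPrime (suc fuel) k with prime? k
... | yes _ = k
... | no _ = searchPrime fuel (suc k)

-- least prime > q  (one exists in (q, q!+1], so fuel q! suffices)
nextPrime : ℕ → ℕ
nextPrime q = searchPrime (q !) (suc q)

-- p i = i-th prime for i ≥ 1 (p 1 = 2, p 2 = 3, ...); p 0 = 1 is a junk value, never used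
p : ℕ → ℕ
p zero = 1
p (suc i) = nextPrime (p i)

primorial : ℕ → ℕ
primorial zero = 1
primorial (suc m) = primorial m * p (suc m)

Totative : ℕ → ℕ → Set
Totative m t = 2 ≤ t × t ≤ primorial m + 1 × Coprime t (primorial m)

Satisfies : ∀ {k} → ℕ → Vec ℕ k → ℕ → Set
Satisfies {k} m a t = Totative m t × (∀ (i : Fin k) → Totative m (t + lookup a i))

Admissible : ∀ {k} → ℕ → Vec ℕ k → Set
Admissible {k} m a =
  (∀ (i : Fin k) → toℕ i ≡ 0 → lookup a i ≡ 0) ×
  (∀ (i j : Fin k) → toℕ j ≡ suc (toℕ i) → lookup a i < lookup a j) ×
  (∀ m' → m ≤ m' → Σ ℕ λ t → Satisfies m' a t)

gap : ∀ {k} → Vec ℕ k → ℕ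
gap [] = 0
gap (x ∷ []) = 0
gap (x ∷ y ∷ ys) = (y ∸ x) ⊔ gap (y ∷ ys)

-- Write t − 2 = r + #(n-1)·j with r < #(n-1) and put t' = 2 + r; then j < p_n since t ≤ #(n) + 1.
-- A common factor of #(n-1) and t' + a_i would also divide t + a_i and #(n) = #(n-1)·p_n, so t'
-- and every t' + a_i are coprime to #(n-1). No t' + a_i exceeds #(n-1) + 1: walking along the
-- tuple from t' + a_1 = t', the first entry to exceed it would be #(n-1) + j with
-- 2 ≤ j ≤ gap(a) + 1 < p_n, and such a j has a prime factor below p_n, which divides #(n-1).
module Submission where

open import Defs
open import Data.Nat
  using (ℕ; zero; suc; _+_; _*_; _∸_; _≤_; _<_; _!; s≤s; s≤s⁻¹; z≤n; NonZero; _≤?_; >-nonZero; nonTrivial⇒n>1)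
open import Data.Nat.Properties
open import Algebra.Properties.CommutativeSemigroup +-commutativeSemigroup using (xy∙z≈xz∙y)
open import Data.Nat.Divisibility using (_∣_; ∣-trans; ∣m∣n⇒∣m+n; ∣m⇒∣m*n; n∣m*n; m∣m*n; ∣⇒≤; ∣-refl)
open import Data.Nat.DivMod using (_/_; _%_; m≡m%n+[m/n]*n; m%n<n; m<n*o⇒m/o<n)
open import Data.Nat.Primality using (Prime; prime?; prime⇒nonTrivial)
open import Data.Nat.Primality.Factorisation using (factorise)
open import Data.Nat.Coprimality using (Coprime)
open import Data.List using ([]; _∷_)
open import Data.List.Relation.Unary.All using (_∷_)
open import Data.Fin using () renaming (zero to fzero; suc to fsuc)
open import Data.Vec using (Vec; _∷_; lookup)
open import Data.Product using (Σ; ∃-syntax; _×_; _,_; proj₂)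
open import Data.Sum using (inj₁; inj₂)
open import Data.Empty using (⊥-elim)
open import Relation.Nullary using (¬_; yes; no; contradiction)
open import Relation.Binary.PropositionalEquality
  using (_≡_; refl; sym; trans; cong; subst; module ≡-Reasoning)

searchPrime-skips : ∀ fuel {k r} → k ≤ r → r < searchPrime fuel k → ¬ Prime r
searchPrime-skips zero k≤r r<k = contradiction k≤r (<⇒≱ r<k)
searchPrime-skips (suc fuel) {k} {r} k≤r r<s with prime? k
... | yes _ = contradiction k≤r (<⇒≱ r<s)
... | no ¬pk with k ≟ r
...   | yes refl = ¬pk
...   | no k≢r = searchPrime-skips fuel (≤∧≢⇒< k≤r k≢r) r<s

k≤searchPrime : ∀ fuel k → k ≤ searchPrime fuel k
k≤searchPrime zero k = ≤-refl
k≤searchPrime (suc fuel) k with prime? k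
... | yes _ = ≤-refl
... | no _ = ≤-trans (n≤1+n k) (k≤searchPrime fuel (suc k))

q<nextPrime : ∀ q → q < nextPrime q
q<nextPrime q = k≤searchPrime (q !) (suc q)

nextPrime-skips : ∀ {q r} → q < r → r < nextPrime q → ¬ Prime r
nextPrime-skips {q} = searchPrime-skips (q !)

p-nonZero : ∀ i → NonZero (p i)
p-nonZero zero = _
p-nonZero (suc i) = >-nonZero (≤-<-trans z≤n (q<nextPrime (p i)))

primorial-nonZero : ∀ m → NonZero (primorial m)
primorial-nonZero zero = _
primorial-nonZero (suc m) =
  m*n≢0 (primorial m) (p (suc m)) {{primorial-nonZero m}} {{p-nonZero (suc m)}}

prime<p[1+m]⇒∣primorial : ∀ m {r} → Prime r → r < p (suc m) → r ∣ primorial m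
prime<p[1+m]⇒∣primorial m {r} pr r<q with r ≤? p m
... | no r≰pm = contradiction pr (nextPrime-skips (≰⇒> r≰pm) r<q)
prime<p[1+m]⇒∣primorial zero pr _ | yes r≤1 =
  contradiction r≤1 (<⇒≱ (nonTrivial⇒n>1 _ {{prime⇒nonTrivial pr}}))
prime<p[1+m]⇒∣primorial (suc m) pr _ | yes r≤pm with m≤n⇒m<n∨m≡n r≤pm
... | inj₁ r<pm = ∣m⇒∣m*n (p (suc m)) (prime<p[1+m]⇒∣primorial m pr r<pm)
... | inj₂ refl = n∣m*n (primorial m)

∃prime∣ : ∀ {n} → 2 ≤ n → ∃[ r ] Prime r × r ∣ n
∃prime∣ {n} 2≤n with factorise n {{>-nonZero (≤-trans (s≤s z≤n) 2≤n)}}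
... | record { factors = [] ; isFactorisation = n≡1 } =
  contradiction (subst (2 ≤_) n≡1 2≤n) λ { (s≤s ()) }
... | record { factors = r ∷ rs ; isFactorisation = n≡r*rs ; factorsPrime = pr ∷ _ } =
  r , pr , subst (r ∣_) (sym n≡r*rs) (m∣m*n _)

coprime-∣ʳ : ∀ {m n d} → d ∣ n → Coprime m n → Coprime m d
coprime-∣ʳ d∣n m⊥n (i∣m , i∣d) = m⊥n (i∣m , ∣-trans i∣d d∣n)

coprime-+⇒coprime : ∀ {m n k} → n ∣ k → Coprime (m + k) n → Coprime m n
coprime-+⇒coprime n∣k m+k⊥n (i∣m , i∣n) = m+k⊥n (∣m∣n⇒∣m+n i∣m (∣-trans i∣n n∣k) , i∣n)

¬coprime[j,primorial] : ∀ m {j} → 2 ≤ j → j < p (suc m) → ¬ Coprime j (primorial m)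
¬coprime[j,primorial] m 2≤j j<q j⊥P with ∃prime∣ 2≤j
... | r , pr , r∣j with j⊥P (r∣j , prime<p[1+m]⇒∣primorial m pr (≤-<-trans r≤j j<q))
  where r≤j = ∣⇒≤ {{>-nonZero (≤-trans (s≤s z≤n) 2≤j)}} r∣j
...   | refl = contradiction (nonTrivial⇒n>1 1 {{prime⇒nonTrivial pr}}) λ { (s≤s ()) }

coprime-window : ∀ m {u w g} → u ≤ primorial m + 1 → w ≤ u + g → suc g < p (suc m) →
                 Coprime w (primorial m) → w ≤ primorial m + 1
coprime-window m {u} {w} {g} u≤P+1 w≤u+g 1+g<q w⊥P with w ≤? primorial m + 1
... | yes w≤P+1 = w≤P+1
... | no w≰P+1 = ⊥-elim (¬coprime[j,primorial] m 2≤j (≤-<-trans j≤1+g 1+g<q) j⊥P)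
  where
  P = primorial m
  j = w ∸ P
  P+2≤w : P + 2 ≤ w
  P+2≤w = subst (_≤ w) (sym (+-suc P 1)) (≰⇒> w≰P+1)
  w≡j+P : w ≡ j + P
  w≡j+P = trans (sym (m+[n∸m]≡n (≤-trans (m≤m+n P 2) P+2≤w))) (+-comm P j)
  2≤j : 2 ≤ j
  2≤j = subst (_≤ j) (m+n∸m≡n P 2) (∸-monoˡ-≤ P P+2≤w)
  w≤P+1+g : w ≤ P + suc g
  w≤P+1+g = ≤-trans w≤u+g (subst (u + g ≤_) (+-assoc P 1 g) (+-monoˡ-≤ g u≤P+1))
  j≤1+g : j ≤ suc g
  j≤1+g = subst (j ≤_) (m+n∸m≡n P (suc g)) (∸-monoˡ-≤ P w≤P+1+g)
  j⊥P : Coprime j P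
  j⊥P = coprime-+⇒coprime ∣-refl (subst (λ z → Coprime z P) w≡j+P w⊥P)

coprime-reduce : ∀ {s s′ P q j} → s ≡ s′ + P * j → Coprime s (P * q) → Coprime s′ P
coprime-reduce {P = P} {q} {j} s≡ s⊥Pq =
  coprime-+⇒coprime (m∣m*n j) (subst (λ z → Coprime z P) s≡ (coprime-∣ʳ (m∣m*n q) s⊥Pq))

entries≤primorial+1 : ∀ m {t k} x (v : Vec ℕ k) → suc (gap (x ∷ v)) < p (suc m) →
  t + x ≤ primorial m + 1 → (∀ i → Coprime (t + lookup (x ∷ v) i) (primorial m)) →
  ∀ i → t + lookup (x ∷ v) i ≤ primorial m + 1
entries≤primorial+1 m x v gap<q t+x≤ entries⊥ fzero = t+x≤
entries≤primorial+1 m {t} x (y ∷ ys) gap<q t+x≤ entries⊥ (fsuc i) =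
  entries≤primorial+1 m y ys (≤-<-trans (s≤s (m≤n⊔m (y ∸ x) _)) gap<q) t+y≤
    (λ i → entries⊥ (fsuc i)) i
  where
  t+y≤t+x+[y∸x] : t + y ≤ t + x + (y ∸ x)
  t+y≤t+x+[y∸x] = subst (t + y ≤_) (sym (+-assoc t x (y ∸ x))) (+-monoʳ-≤ t (m≤n+m∸n y x))
  t+y≤ : t + y ≤ primorial m + 1
  t+y≤ = coprime-window m t+x≤ t+y≤t+x+[y∸x]
           (≤-<-trans (s≤s (m≤m⊔n (y ∸ x) _)) gap<q) (entries⊥ (fsuc fzero))

shifted-divMod : ∀ P q .{{_ : NonZero P}} {t} → 2 ≤ t → t ≤ P * q + 1 →
                 ∃[ r ] ∃[ j ] 2 ≤ r × r ≤ P + 1 × j < q × t ≡ r + P * j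
shifted-divMod P q {t} 2≤t t≤Pq+1 =
  2 + s % P , s / P , s≤s (s≤s z≤n) , r≤P+1 , j<q , t≡r+Pj
  where
  s = t ∸ 2
  2+s≡t : 2 + s ≡ t
  2+s≡t = m+[n∸m]≡n 2≤t
  r≤P+1 : 2 + s % P ≤ P + 1
  r≤P+1 = subst (2 + s % P ≤_) (+-comm 1 P) (s≤s (m%n<n s P))
  j<q : s / P < q
  j<q = m<n*o⇒m/o<n (subst (s <_) (*-comm P q)
          (s≤s⁻¹ (subst (_≤ 1 + P * q) (sym 2+s≡t) (subst (t ≤_) (+-comm (P * q) 1) t≤Pq+1))))
  t≡r+Pj : t ≡ 2 + s % P + P * (s / P)
  t≡r+Pj = begin
    t                           ≡⟨ sym 2+s≡t ⟩
    2 + s                       ≡⟨ cong (2 +_) (m≡m%n+[m/n]*n s P) ⟩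
    2 + (s % P + s / P * P)     ≡⟨ cong (λ z → 2 + (s % P + z)) (*-comm (s / P) P) ⟩
    2 + s % P + P * (s / P)     ∎
    where open ≡-Reasoning

theorem2 : (n : ℕ) → 1 ≤ n → (k : ℕ) → 2 ≤ k → (a : Vec ℕ k) →
    Admissible (n ∸ 1) a → gap a < p n ∸ 1 →
    (t : ℕ) → Satisfies n a t →
    Σ ℕ λ t' → Σ ℕ λ j →
    j ≤ p n ∸ 1 × Totative (n ∸ 1) t' ×
    t ≡ t' + primorial (n ∸ 1) * j × Satisfies (n ∸ 1) a t'
theorem2 (suc m) _ (suc k) _ a@(x ∷ v) (a₁≡0 , _ , _) gap<q-1 t ((2≤t , t≤ , t⊥) , entries)
  with shifted-divMod (primorial m) (p (suc m)) {{primorial-nonZero m}} 2≤t t≤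
... | t′ , j , 2≤t′ , t′≤ , j<q , t≡ =
  t′ , j , <⇒≤pred j<q , t′-totative , t≡ , t′-totative , entry-totative
  where
  P = primorial m
  t′-totative : Totative m t′
  t′-totative = 2≤t′ , t′≤ , coprime-reduce t≡ t⊥
  entries⊥ : ∀ i → Coprime (t′ + lookup a i) P
  entries⊥ i = coprime-reduce
    (trans (cong (_+ lookup a i) t≡) (xy∙z≈xz∙y t′ (P * j) (lookup a i)))
    (proj₂ (proj₂ (entries i)))
  t′+x≤ : t′ + x ≤ P + 1
  t′+x≤ = subst (λ z → t′ + z ≤ P + 1) (sym (a₁≡0 fzero refl))
            (subst (_≤ P + 1) (sym (+-identityʳ t′)) t′≤)
  gap<q : suc (gap a) < p (suc m)
  gap<q = m≤pred[n]⇒suc[m]≤n {{p-nonZero (suc m)}} gap<q-1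
  entry-totative : ∀ i → Totative m (t′ + lookup a i)
  entry-totative i = ≤-trans 2≤t′ (m≤m+n t′ (lookup a i)) ,
    entries≤primorial+1 m x v gap<q t′+x≤ entries⊥ i , entries⊥ i
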